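{- For any $n\ge 3$ and any Greene–Kleitman chain $C$ of $Q_n$ with $|C|\ge 3$, the chains $f({*}C{*})$ and $f({*}\ell(C){*})$ are connected at their bottom ends in $Q_{n+2}$ (i.e., their bottom ends are adjacent). Specifically, if $C=u*C'$ with $u\in D$ and $|C'|\ge 2$, then $f({*}C{*})=0\,u\,1\,C'\,{*}$ and $f({*}\ell(C){*})=0\,u\,1\,\ell(C')\,{*}$, i.e., the chains $f({*}C{*})$ and $f({*}\ell(C){*})$ differ in exactly two positions.
   Context: $Q_n$: vertices are bitstrings of length $n$, adjacent if they differ in one bit. $D$ is the set of bitstrings (including the empty string) with equally many 0s and 1s such that every prefix has at least as many 0s as 1s. A Greene–Kleitman chain of $Q_n$ is a string $C=u_0*u_1*\cdots*u_h$ of length $n$ over $\{0,1,*\}$ with $u_j\in D$; $|C|=h$ is the number of $*$s; its bottom end is obtained by replacing all $*$s by $0$. For a string $S$ over $\{0,1,*\}$ with at least two $*$s, $f(S)$ (resp. $\ell(S)$) is obtained by replacing the first two (resp. last two) $*$s by $0$ and $1$, respectively. ${*}C{*}$ denotes $C$ with a $*$ prepended and appended. -}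

module Defs where

open import Data.Bool using (Bool; true; false; not; if_then_else_)
open import Data.Nat using (ℕ; zero; suc; _+_)
open import Data.List using (List; []; _∷_; _++_; map; length; reverse)
open import Data.Product using (Σ; ∃; _×_; _,_)
open import Relation.Nullary using (yes; no)
open import Relation.Binary.Definitions using (DecidableEquality)
open import Relation.Binary.PropositionalEquality using (_≡_)

-- Bits: false = 0, true = 1.
Bit : Set
Bit = Bool

data Sym : Set where
  𝟎 𝟏 ⋆ : Sym

bitSym : Bit → Sym
bitSym false = 𝟎
bitSym true  = 𝟏

emb : List Bit → List Sym
emb = map bitSym

-- Bal k w : reading w starting from surplus k (= #0s - #1s so far) never
-- goes negative and ends with surplus 0.
data Bal : ℕ → List Bit → Set where
  done  : Bal 0 []
  zero₀ : ∀ {k w} → Bal (suc k) w → Bal k (false ∷ w)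
  one₁  : ∀ {k w} → Bal k w → Bal (suc k) (true ∷ w)

D : List Bit → Set
D w = Bal 0 w

data All-D : List (List Bit) → Set where
  []  : All-D []
  _∷_ : ∀ {u us} → D u → All-D us → All-D (u ∷ us)

gkString : List Bit → List (List Bit) → List Sym
gkString u₀ []        = emb u₀
gkString u₀ (u ∷ us)  = emb u₀ ++ ⋆ ∷ gkString u us

IsGK : List Sym → Set
IsGK C = Σ (List Bit) λ u₀ → Σ (List (List Bit)) λ us →
           D u₀ × All-D us × C ≡ gkString u₀ us

GKChain : ℕ → List Sym → Set
GKChain n C = length C ≡ n × IsGK C

-- |C| : number of stars
stars : List Sym → ℕ
stars []        = 0
stars (⋆ ∷ s)   = suc (stars s)
stars (_ ∷ s)   = stars s

bottomSym : Sym → Bit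
bottomSym 𝟎 = false
bottomSym 𝟏 = true
bottomSym ⋆ = false

bottom : List Sym → List Bit
bottom = map bottomSym

-- replace the first star by a, the next star by b
-- (identity on remaining parts if fewer stars; only applied to strings with ≥ 2 stars)
replace2 : Sym → Sym → List Sym → List Sym
replace1 : Sym → List Sym → List Sym
replace1 b []        = []
replace1 b (⋆ ∷ s)   = b ∷ s
replace1 b (x ∷ s)   = x ∷ replace1 b s
replace2 a b []      = []
replace2 a b (⋆ ∷ s) = a ∷ replace1 b s
replace2 a b (x ∷ s) = x ∷ replace2 a b s

f : List Sym → List Sym
f = replace2 𝟎 𝟏

-- ℓ(S): last two stars replaced by 0 and 1 respectively
-- (in the reversed string the last star comes first and becomes 1)
ℓ : List Sym → List Sym
ℓ S = reverse (replace2 𝟏 𝟎 (reverse S))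

wrap : List Sym → List Sym
wrap C = ⋆ ∷ C ++ ⋆ ∷ []

-- number of positions in which two strings differ (over the common prefix)
diff : ∀ {A : Set} → DecidableEquality A → List A → List A → ℕ
diff _≟_ (x ∷ xs) (y ∷ ys) with x ≟ y
... | yes _ = diff _≟_ xs ys
... | no  _ = suc (diff _≟_ xs ys)
diff _≟_ _ _ = 0

_≟B_ : DecidableEquality Bit
_≟B_ = Data.Bool._≟_
  where import Data.Bool

_≟S_ : DecidableEquality Sym
𝟎 ≟S 𝟎 = yes _≡_.refl
𝟏 ≟S 𝟏 = yes _≡_.refl
⋆ ≟S ⋆ = yes _≡_.refl
𝟎 ≟S 𝟏 = no λ ()
𝟎 ≟S ⋆ = no λ ()
𝟏 ≟S 𝟎 = no λ ()
𝟏 ≟S ⋆ = no λ ()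
⋆ ≟S 𝟎 = no λ ()
⋆ ≟S 𝟏 = no λ ()

Adjacent : ℕ → List Bit → List Bit → Set
Adjacent m x y = length x ≡ m × length y ≡ m × diff _≟B_ x y ≡ 1

-- Write C = u ⋆ X with u ∈ D.  Prepending a star and applying f only turns the new
-- star and the star after u into 0 and 1, so f(⋆C⋆) = 0 u 1 X ⋆; and when X has at
-- least two stars, ℓ acts inside X, so f(⋆ℓ(C)⋆) = 0 u 1 ℓ(X) ⋆.  Writing
-- X = P ⋆ Q ⋆ R with Q, R star-free, ℓ(X) = P 0 Q 1 R: the two chains differ exactly
-- in two positions, and their bottom ends only where the second star became 1.
module Submission where

open import Defs
open import Data.Nat using (ℕ; _≤_; _+_; suc; pred; s≤s; s≤s⁻¹; z≤n)
open import Data.Nat.Properties using (+-identityʳ; +-suc; ≤-trans)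
open import Data.List using (List; _∷_; []; _++_; reverse; map; length)
open import Data.List.Properties
  using (++-assoc; reverse-++; unfold-reverse; reverse-involutive; map-++; length-map; length-++; length-reverse)
open import Data.Bool using (true; false)
open import Data.Product using (_×_; _,_; ∃-syntax)
open import Function using (_∘_)
open import Relation.Nullary using (yes; no; contradiction)
open import Relation.Binary.Definitions using (DecidableEquality)
open import Relation.Binary.PropositionalEquality using (_≡_; refl; sym; trans; cong; cong₂; subst; module ≡-Reasoning)

fill₂ : {A : Set} → List A → A → List A → A → List A → List A
fill₂ L x M y N = L ++ x ∷ M ++ y ∷ N

module _ {A : Set} where

  fill₂-++ˡ : ∀ (K L : List A) x M y N → K ++ fill₂ L x M y N ≡ fill₂ (K ++ L) x M y N
  fill₂-++ˡ K L x M y N = sym (++-assoc K L _)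

  fill₂-++ʳ : ∀ (L : List A) x M y N T → fill₂ L x M y N ++ T ≡ fill₂ L x M y (N ++ T)
  fill₂-++ʳ L x M y N T =
    trans (++-assoc L _ T) (cong (λ Z → L ++ x ∷ Z) (++-assoc M (y ∷ N) T))

  reverse-++-∷ : ∀ (L : List A) x M → reverse (L ++ x ∷ M) ≡ reverse M ++ x ∷ reverse L
  reverse-++-∷ L x M = begin
    reverse (L ++ x ∷ M)               ≡⟨ reverse-++ L (x ∷ M) ⟩
    reverse (x ∷ M) ++ reverse L       ≡⟨ cong (_++ reverse L) (unfold-reverse x M) ⟩
    (reverse M ++ x ∷ []) ++ reverse L ≡⟨ ++-assoc (reverse M) (x ∷ []) (reverse L) ⟩
    reverse M ++ x ∷ reverse L         ∎
    where open ≡-Reasoning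

  reverse-fill₂ : ∀ (L : List A) x M y N →
    reverse (fill₂ L x M y N) ≡ fill₂ (reverse N) y (reverse M) x (reverse L)
  reverse-fill₂ L x M y N = begin
    reverse (L ++ x ∷ M ++ y ∷ N)                 ≡⟨ reverse-++-∷ L x (M ++ y ∷ N) ⟩
    reverse (M ++ y ∷ N) ++ x ∷ reverse L         ≡⟨ cong (_++ x ∷ reverse L) (reverse-++-∷ M y N) ⟩
    (reverse N ++ y ∷ reverse M) ++ x ∷ reverse L ≡⟨ ++-assoc (reverse N) _ _ ⟩
    fill₂ (reverse N) y (reverse M) x (reverse L) ∎
    where open ≡-Reasoning

  map-fill₂ : ∀ {B : Set} (g : A → B) L x M y N →
    map g (fill₂ L x M y N) ≡ fill₂ (map g L) (g x) (map g M) (g y) (map g N)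
  map-fill₂ g L x M y N =
    trans (map-++ g L _) (cong (λ Z → map g L ++ g x ∷ Z) (map-++ g M _))

module _ {A : Set} (_≟_ : DecidableEquality A) where

  diff-refl : ∀ xs → diff _≟_ xs xs ≡ 0
  diff-refl []       = refl
  diff-refl (x ∷ xs) with x ≟ x
  ... | yes _ = diff-refl xs
  ... | no x≢x = contradiction refl x≢x

  diff-++ : ∀ xs ys {zs ws} → length xs ≡ length ys →
    diff _≟_ (xs ++ zs) (ys ++ ws) ≡ diff _≟_ xs ys + diff _≟_ zs ws
  diff-++ []       []       _   = refl
  diff-++ []       (_ ∷ _)  ()
  diff-++ (_ ∷ _)  []       ()
  diff-++ (x ∷ xs) (y ∷ ys) |xs|≡|ys| with x ≟ y
  ... | yes _ = diff-++ xs ys (cong pred |xs|≡|ys|)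
  ... | no  _ = cong suc (diff-++ xs ys (cong pred |xs|≡|ys|))

  diff-fill₂ : ∀ L x x′ M y y′ N →
    diff _≟_ (fill₂ L x M y N) (fill₂ L x′ M y′ N)
      ≡ diff _≟_ (x ∷ []) (x′ ∷ []) + diff _≟_ (y ∷ []) (y′ ∷ [])
  diff-fill₂ L x x′ M y y′ N = begin
    diff _≟_ (L ++ x ∷ M ++ y ∷ N) (L ++ x′ ∷ M ++ y′ ∷ N)
      ≡⟨ diff-++ L L refl ⟩
    diff _≟_ L L + diff _≟_ (x ∷ M ++ y ∷ N) (x′ ∷ M ++ y′ ∷ N)
      ≡⟨ cong₂ _+_ (diff-refl L) (diff-++ (x ∷ []) (x′ ∷ []) refl) ⟩
    δx + diff _≟_ (M ++ y ∷ N) (M ++ y′ ∷ N)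
      ≡⟨ cong (δx +_) (diff-++ M M refl) ⟩
    δx + (diff _≟_ M M + diff _≟_ (y ∷ N) (y′ ∷ N))
      ≡⟨ cong (λ k → δx + (k + diff _≟_ (y ∷ N) (y′ ∷ N))) (diff-refl M) ⟩
    δx + diff _≟_ (y ∷ N) (y′ ∷ N)
      ≡⟨ cong (δx +_) (diff-++ (y ∷ []) (y′ ∷ []) refl) ⟩
    δx + (δy + diff _≟_ N N)
      ≡⟨ cong (λ k → δx + (δy + k)) (diff-refl N) ⟩
    δx + (δy + 0)
      ≡⟨ cong (δx +_) (+-identityʳ δy) ⟩
    δx + δy ∎
    where
    open ≡-Reasoning
    δx = diff _≟_ (x ∷ []) (x′ ∷ [])
    δy = diff _≟_ (y ∷ []) (y′ ∷ [])

stars-++ : ∀ S T → stars (S ++ T) ≡ stars S + stars T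
stars-++ []      T = refl
stars-++ (𝟎 ∷ S) T = stars-++ S T
stars-++ (𝟏 ∷ S) T = stars-++ S T
stars-++ (⋆ ∷ S) T = cong suc (stars-++ S T)

stars-reverse : ∀ S → stars (reverse S) ≡ stars S
stars-reverse []      = refl
stars-reverse (x ∷ S) = begin
  stars (reverse (x ∷ S))            ≡⟨ cong stars (unfold-reverse x S) ⟩
  stars (reverse S ++ x ∷ [])        ≡⟨ stars-++ (reverse S) (x ∷ []) ⟩
  stars (reverse S) + stars (x ∷ []) ≡⟨ cong (_+ stars (x ∷ [])) (stars-reverse S) ⟩
  stars S + stars (x ∷ [])           ≡⟨ stars-∷ʳ x ⟩
  stars (x ∷ S)                      ∎
  where
  open ≡-Reasoning
  stars-∷ʳ : ∀ x → stars S + stars (x ∷ []) ≡ stars (x ∷ S)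
  stars-∷ʳ 𝟎 = +-identityʳ (stars S)
  stars-∷ʳ 𝟏 = +-identityʳ (stars S)
  stars-∷ʳ ⋆ = trans (+-suc (stars S) 0) (cong suc (+-identityʳ (stars S)))

stars-emb : ∀ u → stars (emb u) ≡ 0
stars-emb []          = refl
stars-emb (false ∷ u) = stars-emb u
stars-emb (true ∷ u)  = stars-emb u

stars-emb-++-⋆ : ∀ u X → stars (emb u ++ ⋆ ∷ X) ≡ suc (stars X)
stars-emb-++-⋆ u X = trans (stars-++ (emb u) (⋆ ∷ X)) (cong (_+ suc (stars X)) (stars-emb u))

≤-stars-tail : ∀ {k} u X → suc k ≤ stars (emb u ++ ⋆ ∷ X) → k ≤ stars X
≤-stars-tail u X k<|C| = s≤s⁻¹ (subst (_ ≤_) (stars-emb-++-⋆ u X) k<|C|)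

replace1-starFree : ∀ b S T → stars S ≡ 0 → replace1 b (S ++ ⋆ ∷ T) ≡ S ++ b ∷ T
replace1-starFree b []      T _  = refl
replace1-starFree b (𝟎 ∷ S) T ∅S = cong (𝟎 ∷_) (replace1-starFree b S T ∅S)
replace1-starFree b (𝟏 ∷ S) T ∅S = cong (𝟏 ∷_) (replace1-starFree b S T ∅S)
replace1-starFree b (⋆ ∷ S) T ()

replace2-starFree : ∀ a b S T → stars S ≡ 0 → replace2 a b (S ++ ⋆ ∷ T) ≡ S ++ a ∷ replace1 b T
replace2-starFree a b []      T _  = refl
replace2-starFree a b (𝟎 ∷ S) T ∅S = cong (𝟎 ∷_) (replace2-starFree a b S T ∅S)
replace2-starFree a b (𝟏 ∷ S) T ∅S = cong (𝟏 ∷_) (replace2-starFree a b S T ∅S)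
replace2-starFree a b (⋆ ∷ S) T ()

replace2-fill₂ : ∀ a b L M N → stars L ≡ 0 → stars M ≡ 0 →
  replace2 a b (fill₂ L ⋆ M ⋆ N) ≡ fill₂ L a M b N
replace2-fill₂ a b L M N ∅L ∅M =
  trans (replace2-starFree a b L _ ∅L) (cong (λ Z → L ++ a ∷ Z) (replace1-starFree b M N ∅M))

length-replace1 : ∀ b S → length (replace1 b S) ≡ length S
length-replace1 b []      = refl
length-replace1 b (𝟎 ∷ S) = cong suc (length-replace1 b S)
length-replace1 b (𝟏 ∷ S) = cong suc (length-replace1 b S)
length-replace1 b (⋆ ∷ S) = refl

length-replace2 : ∀ a b S → length (replace2 a b S) ≡ length S
length-replace2 a b []      = refl
length-replace2 a b (𝟎 ∷ S) = cong suc (length-replace2 a b S)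
length-replace2 a b (𝟏 ∷ S) = cong suc (length-replace2 a b S)
length-replace2 a b (⋆ ∷ S) = cong suc (length-replace1 b S)

length-ℓ : ∀ S → length (ℓ S) ≡ length S
length-ℓ S = trans (length-reverse (replace2 𝟏 𝟎 (reverse S)))
                   (trans (length-replace2 𝟏 𝟎 (reverse S)) (length-reverse S))

length-bottom-f-wrap : ∀ S → length (bottom (f (wrap S))) ≡ length S + 2
length-bottom-f-wrap S = begin
  length (bottom (f (wrap S))) ≡⟨ length-map bottomSym (f (wrap S)) ⟩
  length (f (wrap S))          ≡⟨ length-replace2 𝟎 𝟏 (wrap S) ⟩
  suc (length (S ++ ⋆ ∷ []))   ≡⟨ cong suc (length-++ S) ⟩
  suc (length S + 1)           ≡⟨ +-suc (length S) 1 ⟨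
  length S + 2                 ∎
  where open ≡-Reasoning

ℓ-fill₂ : ∀ P Q R → stars Q ≡ 0 → stars R ≡ 0 → ℓ (fill₂ P ⋆ Q ⋆ R) ≡ fill₂ P 𝟎 Q 𝟏 R
ℓ-fill₂ P Q R ∅Q ∅R = begin
  reverse (replace2 𝟏 𝟎 (reverse (fill₂ P ⋆ Q ⋆ R)))
    ≡⟨ cong (reverse ∘ replace2 𝟏 𝟎) (reverse-fill₂ P ⋆ Q ⋆ R) ⟩
  reverse (replace2 𝟏 𝟎 (fill₂ (reverse R) ⋆ (reverse Q) ⋆ (reverse P)))
    ≡⟨ cong reverse (replace2-fill₂ 𝟏 𝟎 (reverse R) (reverse Q) (reverse P)
                       (trans (stars-reverse R) ∅R) (trans (stars-reverse Q) ∅Q)) ⟩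
  reverse (fill₂ (reverse R) 𝟏 (reverse Q) 𝟎 (reverse P))
    ≡⟨ reverse-fill₂ (reverse R) 𝟏 (reverse Q) 𝟎 (reverse P) ⟩
  fill₂ (reverse (reverse P)) 𝟎 (reverse (reverse Q)) 𝟏 (reverse (reverse R))
    ≡⟨ cong₂ (λ P′ Q′ → fill₂ P′ 𝟎 Q′ 𝟏 (reverse (reverse R)))
             (reverse-involutive P) (reverse-involutive Q) ⟩
  fill₂ P 𝟎 Q 𝟏 (reverse (reverse R))
    ≡⟨ cong (fill₂ P 𝟎 Q 𝟏) (reverse-involutive R) ⟩
  fill₂ P 𝟎 Q 𝟏 R ∎
  where open ≡-Reasoning

ℓ-++-fill₂ : ∀ K P Q R → stars Q ≡ 0 → stars R ≡ 0 →
  ℓ (K ++ fill₂ P ⋆ Q ⋆ R) ≡ K ++ fill₂ P 𝟎 Q 𝟏 R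
ℓ-++-fill₂ K P Q R ∅Q ∅R = begin
  ℓ (K ++ fill₂ P ⋆ Q ⋆ R)   ≡⟨ cong ℓ (fill₂-++ˡ K P ⋆ Q ⋆ R) ⟩
  ℓ (fill₂ (K ++ P) ⋆ Q ⋆ R) ≡⟨ ℓ-fill₂ (K ++ P) Q R ∅Q ∅R ⟩
  fill₂ (K ++ P) 𝟎 Q 𝟏 R     ≡⟨ fill₂-++ˡ K P 𝟎 Q 𝟏 R ⟨
  K ++ fill₂ P 𝟎 Q 𝟏 R       ∎
  where open ≡-Reasoning

data LastStar : List Sym → Set where
  noStar     : ∀ {S} → stars S ≡ 0 → LastStar S
  lastStarAt : ∀ P R → stars R ≡ 0 → LastStar (P ++ ⋆ ∷ R)

lastStar : ∀ S → LastStar S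
lastStar []      = noStar refl
lastStar (x ∷ S) with lastStar S
lastStar (𝟎 ∷ S) | noStar ∅S          = noStar ∅S
lastStar (𝟏 ∷ S) | noStar ∅S          = noStar ∅S
lastStar (⋆ ∷ S) | noStar ∅S          = lastStarAt [] S ∅S
lastStar (x ∷ _) | lastStarAt P R ∅R = lastStarAt (x ∷ P) R ∅R

lastTwoStars : ∀ S → 2 ≤ stars S →
  ∃[ P ] ∃[ Q ] ∃[ R ] stars Q ≡ 0 × stars R ≡ 0 × S ≡ fill₂ P ⋆ Q ⋆ R
lastTwoStars S 2≤|S| with lastStar S
... | noStar ∅S = contradiction (subst (2 ≤_) ∅S 2≤|S|) λ ()
... | lastStarAt P R ∅R with lastStar P
...   | lastStarAt P′ Q ∅Q = P′ , Q , R , ∅Q , ∅R , ++-assoc P′ (⋆ ∷ Q) (⋆ ∷ R)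
...   | noStar ∅P = contradiction (subst (2 ≤_) |P⋆R|≡1 2≤|S|) λ { (s≤s ()) }
  where
  |P⋆R|≡1 : stars (P ++ ⋆ ∷ R) ≡ 1
  |P⋆R|≡1 = trans (stars-++ P (⋆ ∷ R)) (cong₂ (λ p r → p + suc r) ∅P ∅R)

ℓ-++-⋆ : ∀ K X → 2 ≤ stars X → ℓ (K ++ ⋆ ∷ X) ≡ K ++ ⋆ ∷ ℓ X
ℓ-++-⋆ K X 2≤|X| with lastTwoStars X 2≤|X|
... | P , Q , R , ∅Q , ∅R , refl = begin
  ℓ (K ++ fill₂ (⋆ ∷ P) ⋆ Q ⋆ R) ≡⟨ ℓ-++-fill₂ K (⋆ ∷ P) Q R ∅Q ∅R ⟩
  K ++ ⋆ ∷ fill₂ P 𝟎 Q 𝟏 R       ≡⟨ cong (λ Z → K ++ ⋆ ∷ Z) (ℓ-fill₂ P Q R ∅Q ∅R) ⟨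
  K ++ ⋆ ∷ ℓ (fill₂ P ⋆ Q ⋆ R)   ∎
  where open ≡-Reasoning

f-wrap-emb-++-⋆ : ∀ u X → f (wrap (emb u ++ ⋆ ∷ X)) ≡ 𝟎 ∷ emb u ++ 𝟏 ∷ X ++ ⋆ ∷ []
f-wrap-emb-++-⋆ u X = cong (𝟎 ∷_) (begin
  replace1 𝟏 ((emb u ++ ⋆ ∷ X) ++ ⋆ ∷ []) ≡⟨ cong (replace1 𝟏) (++-assoc (emb u) (⋆ ∷ X) (⋆ ∷ [])) ⟩
  replace1 𝟏 (emb u ++ ⋆ ∷ X ++ ⋆ ∷ [])   ≡⟨ replace1-starFree 𝟏 (emb u) (X ++ ⋆ ∷ []) (stars-emb u) ⟩
  emb u ++ 𝟏 ∷ X ++ ⋆ ∷ []               ∎)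
  where open ≡-Reasoning

f-wrap-emb-++-⋆-fill₂ : ∀ u P x Q y R →
  f (wrap (emb u ++ ⋆ ∷ fill₂ P x Q y R)) ≡ fill₂ (𝟎 ∷ emb u ++ 𝟏 ∷ P) x Q y (R ++ ⋆ ∷ [])
f-wrap-emb-++-⋆-fill₂ u P x Q y R = begin
  f (wrap (emb u ++ ⋆ ∷ fill₂ P x Q y R))
    ≡⟨ f-wrap-emb-++-⋆ u (fill₂ P x Q y R) ⟩
  𝟎 ∷ emb u ++ 𝟏 ∷ fill₂ P x Q y R ++ ⋆ ∷ []
    ≡⟨ cong (λ Z → 𝟎 ∷ emb u ++ 𝟏 ∷ Z) (fill₂-++ʳ P x Q y R (⋆ ∷ [])) ⟩
  𝟎 ∷ emb u ++ fill₂ (𝟏 ∷ P) x Q y (R ++ ⋆ ∷ [])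
    ≡⟨ cong (𝟎 ∷_) (fill₂-++ˡ (emb u) (𝟏 ∷ P) x Q y (R ++ ⋆ ∷ [])) ⟩
  fill₂ (𝟎 ∷ emb u ++ 𝟏 ∷ P) x Q y (R ++ ⋆ ∷ []) ∎
  where open ≡-Reasoning

gk-firstStar : ∀ {C} → IsGK C → 1 ≤ stars C → ∃[ u ] ∃[ X ] C ≡ emb u ++ ⋆ ∷ X
gk-firstStar (u , []     , _ , _ , refl) 1≤|C| = contradiction (subst (1 ≤_) (stars-emb u) 1≤|C|) λ ()
gk-firstStar (u , v ∷ vs , _ , _ , refl) _     = u , gkString v vs , refl

f-wrap-ℓ-fill₂ : ∀ {C} → IsGK C → 3 ≤ stars C →
  ∃[ L ] ∃[ M ] ∃[ N ] f (wrap C) ≡ fill₂ L ⋆ M ⋆ N × f (wrap (ℓ C)) ≡ fill₂ L 𝟎 M 𝟏 N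
f-wrap-ℓ-fill₂ gk 3≤|C| with gk-firstStar gk (≤-trans (s≤s z≤n) 3≤|C|)
... | u , X , refl with lastTwoStars X (≤-stars-tail u X 3≤|C|)
...   | P , Q , R , ∅Q , ∅R , refl =
  𝟎 ∷ emb u ++ 𝟏 ∷ P , Q , R ++ ⋆ ∷ [] , f-wrap-emb-++-⋆-fill₂ u P ⋆ Q ⋆ R ,
  trans (cong (f ∘ wrap) (ℓ-++-fill₂ (emb u) (⋆ ∷ P) Q R ∅Q ∅R)) (f-wrap-emb-++-⋆-fill₂ u P 𝟎 Q 𝟏 R)

f-wrap-at-head : ∀ {C} u X → 3 ≤ stars C → C ≡ emb u ++ ⋆ ∷ X →
  f (wrap C) ≡ 𝟎 ∷ emb u ++ 𝟏 ∷ X ++ ⋆ ∷ []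
  × f (wrap (ℓ C)) ≡ 𝟎 ∷ emb u ++ 𝟏 ∷ ℓ X ++ ⋆ ∷ []
f-wrap-at-head u X 3≤|C| refl =
  f-wrap-emb-++-⋆ u X ,
  trans (cong (f ∘ wrap) (ℓ-++-⋆ (emb u) X (≤-stars-tail u X 3≤|C|))) (f-wrap-emb-++-⋆ u (ℓ X))

diff-fill₂-⋆⋆-𝟎𝟏 : ∀ L M N → diff _≟S_ (fill₂ L ⋆ M ⋆ N) (fill₂ L 𝟎 M 𝟏 N) ≡ 2
diff-fill₂-⋆⋆-𝟎𝟏 L M N = diff-fill₂ _≟S_ L ⋆ 𝟎 M ⋆ 𝟏 N

-- The star filled with 0 has the same bottom bit as before; only the one filled with 1 changes.
diff-bottom-fill₂-⋆⋆-𝟎𝟏 : ∀ L M N →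
  diff _≟B_ (bottom (fill₂ L ⋆ M ⋆ N)) (bottom (fill₂ L 𝟎 M 𝟏 N)) ≡ 1
diff-bottom-fill₂-⋆⋆-𝟎𝟏 L M N =
  trans (cong₂ (diff _≟B_) (map-fill₂ bottomSym L ⋆ M ⋆ N) (map-fill₂ bottomSym L 𝟎 M 𝟏 N))
        (diff-fill₂ _≟B_ (bottom L) false false (bottom M) false true (bottom N))

lemma21 : (n : ℕ) (C : List Sym) → 3 ≤ n → GKChain n C → 3 ≤ stars C →
    Adjacent (n + 2) (bottom (f (wrap C))) (bottom (f (wrap (ℓ C))))
    × diff _≟S_ (f (wrap C)) (f (wrap (ℓ C))) ≡ 2
    × ((u : List Bit) (C′ : List Sym) → D u → C ≡ emb u ++ ⋆ ∷ C′ →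
        f (wrap C) ≡ 𝟎 ∷ emb u ++ 𝟏 ∷ C′ ++ ⋆ ∷ []
        × f (wrap (ℓ C)) ≡ 𝟎 ∷ emb u ++ 𝟏 ∷ ℓ C′ ++ ⋆ ∷ [])
lemma21 n C _ (|C|≡n , gk) 3≤|C| with f-wrap-ℓ-fill₂ gk 3≤|C|
... | L , M , N , fC≡ , fℓC≡ =
  ( trans (length-bottom-f-wrap C) (cong (_+ 2) |C|≡n)
  , trans (length-bottom-f-wrap (ℓ C)) (cong (_+ 2) (trans (length-ℓ C) |C|≡n))
  , trans (cong₂ (λ S T → diff _≟B_ (bottom S) (bottom T)) fC≡ fℓC≡) (diff-bottom-fill₂-⋆⋆-𝟎𝟏 L M N) )
  , trans (cong₂ (diff _≟S_) fC≡ fℓC≡) (diff-fill₂-⋆⋆-𝟎𝟏 L M N)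
  , λ u C′ _ → f-wrap-at-head u C′ 3≤|C|
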